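{- Let $m$ be a positive integer. Consider the following pairs $(u,v)$ of cyclic binary words of length $n$: (i) $n=4m+3$ (with $m\ge 2$): $u=0^{m-2}1\,0^{m-1}1\,0^{m+1}1\,0^{m+1}1$, $v=0^{m-1}1\,0^{m-2}1\,0^{m+1}1\,0^{m+1}1$; (ii) $n=4m+4$ (with $m\ge 2$): $u=0^{m-2}1\,0^{m}1\,0^{m+1}1\,0^{m+1}1$, $v=0^{m}1\,0^{m-2}1\,0^{m+1}1\,0^{m+1}1$; (iii) $n=4m+5$ (with $m\ge1$): $u=0^{m-1}1\,0^{m}1\,0^{m+1}1\,0^{m+1}1$, $v=0^{m}1\,0^{m-1}1\,0^{m+1}1\,0^{m+1}1$; (iv) $n=4m+6$ (with $m\ge 2$): $u=0^{m-2}1\,0^{m}1\,0^{m+2}1\,0^{m+2}1$, $v=0^{m}1\,0^{m-2}1\,0^{m+2}1\,0^{m+2}1$. Then in case (i), (ii), (iii), (iv) respectively, $u$ and $v$ have a distinguishing subword of length $3m+2$, $3m+3$, $3m+5$, $3m+3$, and they have no distinguishing subword of smaller length.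
   Context: The alphabet is $\{0,1\}$. A cyclic word is an equivalence class of finite words under conjugacy; its length is the length of a representative. If a cyclic word $w$ has representative $w_1\cdots w_n$, a subword of $w$ is any cyclic word with a representative $w_{i_1}\cdots w_{i_k}$, $1\le i_1<\dots<i_k\le n$. For cyclic words $u,v$, a distinguishing subword is a cyclic word that is a subword of exactly one of $u$ and $v$. $0^0$ denotes the empty word. -}

module Defs where

open import Data.Nat using (ℕ; _+_; _*_; _∸_; _<_)
open import Data.Fin using (Fin; zero; suc)
open import Data.List using (List; []; _∷_; _++_; drop; take; replicate; length)
open import Data.List.Relation.Binary.Sublist.Propositional using (_⊆_)
open import Data.Product using (Σ; ∃; _×_)
open import Data.Sum using (_⊎_)
open import Relation.Nullary using (¬_)
open import Relation.Binary.PropositionalEquality using (_≡_)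

-- Binary alphabet {0,1}; words are lists (representatives of cyclic words).
Word : Set
Word = List (Fin 2)

𝟘 𝟙 : Fin 2
𝟘 = zero
𝟙 = suc zero

block : ℕ → Word
block a = replicate a 𝟘 ++ (𝟙 ∷ [])

w4 : ℕ → ℕ → ℕ → ℕ → Word
w4 a b c d = block a ++ block b ++ block c ++ block d

-- rotation (conjugation); rotate k w for k ≥ length w is w itself.
rotate : ℕ → Word → Word
rotate k w = drop k w ++ take k w

CycSubword : Word → Word → Set
CycSubword x w = Σ ℕ λ i → Σ ℕ λ j → rotate i x ⊆ rotate j w

Distinguishing : Word → Word → Word → Set
Distinguishing x u v =
  (CycSubword x u × ¬ CycSubword x v) ⊎ (¬ CycSubword x u × CycSubword x v)

MinDistLength : ℕ → Word → Word → Set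
MinDistLength L u v =
  (∃ λ x → length x ≡ L × Distinguishing x u v)
  × (∀ x → length x < L → ¬ Distinguishing x u v)

-- Both words are given by their gap sequences: u has gaps (p, q, r, r) and v has gaps (q, p, r, r),
-- with p < q < r (cases (i)–(iv) are p, q, r = m−2, m−1, m+1; m−2, m, m+1; m−1, m, m+1; m−2, m, m+2),
-- and the claimed length is 2p + q + 7 throughout.
-- A subword of u keeps some of its four 1s and at most g zeros of each gap g; up to conjugacy it is
-- determined by the cyclic sequence of its own gaps, each a sum of consecutive zero-runs.  For each
-- choice of kept 1s these gaps can be redistributed over the gaps of v, unless they are too large to
-- fit, and that forces length at least 2p + q + 7.  The word 1 0^(p+1) 1 0^(p+1) 1 0^(q+1) 1 of exactly
-- that length lies in u but not in v, as no rotation of its gaps (0, p+1, p+1, q+1) is bounded by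
-- (q, p, r, r).  Reversal maps v to a conjugate of u, so short subwords of v are subwords of u too.

module Submission where

open import Data.Bool using (Bool; true; false)
open import Data.Empty using (⊥; ⊥-elim)
open import Data.Fin using (zero; suc)
open import Data.List using (List; []; _∷_; _++_; [_]; drop; take; replicate; length; reverse; map)
open import Data.List.Properties
  using ( ++-assoc; ++-identityʳ; ++-conicalˡ; ++-conicalʳ; ∷-injective; ∷-injectiveʳ
        ; take++drop≡id; length-++; length-replicate; length-reverse
        ; reverse-++; unfold-reverse; reverse-involutive )
open import Data.List.Relation.Binary.Pointwise using (Pointwise; []; _∷_)
open import Data.List.Relation.Binary.Sublist.Propositional using (_⊆_; []; _∷_; _∷ʳ_)
open import Data.List.Relation.Binary.Sublist.Propositional.Properties using (++⁺; reverse⁺)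
open import Data.Nat using (ℕ; zero; suc; _+_; _*_; _∸_; _≤_; _<_; _≤?_; z≤n; s≤s)
open import Data.Nat.ListAction using (sum)
open import Data.Nat.Properties
  using ( +-comm; +-assoc; +-identityʳ; +-suc; suc-injective
        ; ≤-refl; ≤-reflexive; ≤-trans; <-≤-trans; <⇒≤; <⇒≱; ≰⇒>; 1+n≰n
        ; n<1+n; n≤1+n; m≤m+n; m≤n+m; m<m+n; m≤n⇒m≤1+n; m≤n+o⇒m∸n≤o; m+[n∸m]≡n
        ; +-mono-≤; +-monoˡ-≤; +-monoʳ-≤; module ≤-Reasoning )
open import Data.Nat.Tactic.RingSolver using (solve-∀)
open import Data.Product using (∃; ∃₂; _×_; _,_; proj₁)
open import Data.Sum using (_⊎_; inj₁; inj₂)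
open import Function using (_∘_)
open import Relation.Nullary using (¬_; yes; no)
open import Relation.Binary.PropositionalEquality hiding ([_])

open import Defs

private variable
  A B : Set
  xs ys zs : List A

infix 4 _∼_
_∼_ : List A → List A → Set
xs ∼ ys = ∃₂ λ us vs → xs ≡ us ++ vs × ys ≡ vs ++ us

∼-swap : (us vs : List A) → us ++ vs ∼ vs ++ us
∼-swap us vs = us , vs , refl , refl

∼-reflexive : xs ≡ ys → xs ∼ ys
∼-reflexive {xs = xs} refl = [] , xs , refl , sym (++-identityʳ xs)

∼-refl : xs ∼ xs
∼-refl = ∼-reflexive refl

∼-sym : xs ∼ ys → ys ∼ xs
∼-sym (us , vs , p , q) = vs , us , q , p

++-≡-++-cases : (as bs cs ds : List A) → as ++ bs ≡ cs ++ ds →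
  (∃ λ es → as ≡ cs ++ es × ds ≡ es ++ bs) ⊎ (∃ λ es → cs ≡ as ++ es × bs ≡ es ++ ds)
++-≡-++-cases []       bs cs       ds eq = inj₂ (cs , refl , eq)
++-≡-++-cases (a ∷ as) bs []       ds eq = inj₁ (a ∷ as , refl , sym eq)
++-≡-++-cases (a ∷ as) bs (c ∷ cs) ds eq with ∷-injective eq
... | refl , eq′ with ++-≡-++-cases as bs cs ds eq′
...   | inj₁ (es , p , q) = inj₁ (es , cong (a ∷_) p , q)
...   | inj₂ (es , p , q) = inj₂ (es , cong (a ∷_) p , q)

∼-trans : xs ∼ ys → ys ∼ zs → xs ∼ zs
∼-trans (us , vs , refl , p) (us′ , vs′ , q , refl) with ++-≡-++-cases vs us us′ vs′ (trans (sym p) q)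
... | inj₁ (es , refl , refl) = us ++ us′ , es , sym (++-assoc us us′ es) , ++-assoc es us us′
... | inj₂ (es , refl , refl) = es , vs′ ++ vs , ++-assoc es vs′ vs , sym (++-assoc vs′ vs es)

∼-hom : (f : List A → List B) → (∀ us vs → f (us ++ vs) ≡ f us ++ f vs) → xs ∼ ys → f xs ∼ f ys
∼-hom f f-++ (us , vs , refl , refl) = f us , f vs , f-++ us vs , f-++ vs us

∼-invariant : (f : List A → ℕ) → (∀ us vs → f (us ++ vs) ≡ f us + f vs) → xs ∼ ys → f xs ≡ f ys
∼-invariant f f-++ (us , vs , refl , refl) =
  trans (f-++ us vs) (trans (+-comm (f us) (f vs)) (sym (f-++ vs us)))

∼-length : xs ∼ ys → length xs ≡ length ys
∼-length = ∼-invariant length (λ us _ → length-++ us)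

∼-reverse : xs ∼ ys → reverse xs ∼ reverse ys
∼-reverse (us , vs , refl , refl) = reverse vs , reverse us , reverse-++ us vs , reverse-++ vs us

rotate-∼ : ∀ n (xs : List A) → xs ∼ drop n xs ++ take n xs
rotate-∼ n xs = take n xs , drop n xs , sym (take++drop≡id n xs) , refl

drop-length-++ : (us vs : List A) → drop (length us) (us ++ vs) ≡ vs
drop-length-++ []       vs = refl
drop-length-++ (u ∷ us) vs = drop-length-++ us vs

take-length-++ : (us vs : List A) → take (length us) (us ++ vs) ≡ us
take-length-++ []       vs = refl
take-length-++ (u ∷ us) vs = cong (u ∷_) (take-length-++ us vs)

∼⇒rotate : xs ∼ ys → ∃ λ n → drop n xs ++ take n xs ≡ ys
∼⇒rotate (us , vs , refl , refl) = length us , cong₂ _++_ (drop-length-++ us vs) (take-length-++ us vs)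

⊆-++-split : (us vs : List A) → xs ⊆ us ++ vs →
  ∃₂ λ xs₁ xs₂ → xs ≡ xs₁ ++ xs₂ × xs₁ ⊆ us × xs₂ ⊆ vs
⊆-++-split []       vs s = [] , _ , refl , [] , s
⊆-++-split (u ∷ us) vs (.u ∷ʳ s) with ⊆-++-split us vs s
... | xs₁ , xs₂ , refl , s₁ , s₂ = xs₁ , xs₂ , refl , u ∷ʳ s₁ , s₂
⊆-++-split (u ∷ us) vs (refl ∷ s) with ⊆-++-split us vs s
... | xs₁ , xs₂ , refl , s₁ , s₂ = u ∷ xs₁ , xs₂ , refl , refl ∷ s₁ , s₂

infix 4 _⊆ᶜ_
_⊆ᶜ_ : List A → List A → Set
xs ⊆ᶜ ws = ∃ λ ys → xs ∼ ys × ys ⊆ ws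

⊆-∼ : xs ⊆ ys → ys ∼ zs → xs ⊆ᶜ zs
⊆-∼ s (us , vs , refl , refl) with ⊆-++-split us vs s
... | xs₁ , xs₂ , refl , s₁ , s₂ = xs₂ ++ xs₁ , ∼-swap xs₁ xs₂ , ++⁺ s₂ s₁

⊆ᶜ-respʳ-∼ : xs ⊆ᶜ ys → ys ∼ zs → xs ⊆ᶜ zs
⊆ᶜ-respʳ-∼ (_ , c , s) c′ with ⊆-∼ s c′
... | ys′ , c″ , s′ = ys′ , ∼-trans c c″ , s′

⊆ᶜ-respˡ-∼ : xs ∼ ys → ys ⊆ᶜ zs → xs ⊆ᶜ zs
⊆ᶜ-respˡ-∼ c (ws , c′ , s) = ws , ∼-trans c c′ , s

⊆ᶜ-reverse : xs ⊆ᶜ ys → reverse xs ⊆ᶜ reverse ys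
⊆ᶜ-reverse (_ , c , s) = _ , ∼-reverse c , reverse⁺ s

CycSubword⇒⊆ᶜ : ∀ {x w} → CycSubword x w → x ⊆ᶜ w
CycSubword⇒⊆ᶜ {x} {w} (i , j , s) with ⊆-∼ s (∼-sym (rotate-∼ j w))
... | y , c , s′ = y , ∼-trans (rotate-∼ i x) c , s′

⊆ᶜ⇒CycSubword : ∀ {x w} → x ⊆ᶜ w → CycSubword x w
⊆ᶜ⇒CycSubword {x} {w} (y , c , s) with ∼⇒rotate c
... | i , refl = i , 0 , subst (_ ⊆_) (sym (++-identityʳ w)) s

zeros : ℕ → Word
zeros k = replicate k 𝟘

zeros-+ : ∀ a b (w : Word) → zeros a ++ zeros b ++ w ≡ zeros (a + b) ++ w
zeros-+ zero    b w = refl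
zeros-+ (suc a) b w = cong (𝟘 ∷_) (zeros-+ a b w)

block-++ : ∀ g (w : Word) → block g ++ w ≡ zeros g ++ 𝟙 ∷ w
block-++ g w = ++-assoc (zeros g) [ 𝟙 ] w

blocks : List ℕ → Word
blocks []       = []
blocks (g ∷ gs) = block g ++ blocks gs

blocks-++ : ∀ gs hs → blocks (gs ++ hs) ≡ blocks gs ++ blocks hs
blocks-++ []       hs = refl
blocks-++ (g ∷ gs) hs = trans (cong (block g ++_) (blocks-++ gs hs)) (sym (++-assoc (block g) (blocks gs) (blocks hs)))

w4≡blocks : ∀ a b c d → w4 a b c d ≡ blocks (a ∷ b ∷ c ∷ d ∷ [])
w4≡blocks a b c d = cong (λ w → block a ++ block b ++ block c ++ w) (sym (++-identityʳ (block d)))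

Piece : Set
Piece = ℕ × Bool

oneIf : Bool → Word → Word
oneIf true  w = 𝟙 ∷ w
oneIf false w = w

pieces : List Piece → Word
pieces []             = []
pieces ((k , e) ∷ ps) = zeros k ++ oneIf e (pieces ps)

pieces-++ : ∀ ps qs → pieces (ps ++ qs) ≡ pieces ps ++ pieces qs
pieces-++ []             qs = refl
pieces-++ ((k , true) ∷ ps) qs =
  trans (cong (λ w → zeros k ++ 𝟙 ∷ w) (pieces-++ ps qs)) (sym (++-assoc (zeros k) _ (pieces qs)))
pieces-++ ((k , false) ∷ ps) qs =
  trans (cong (zeros k ++_) (pieces-++ ps qs)) (sym (++-assoc (zeros k) _ (pieces qs)))

pieces-∼ : ∀ {ps qs} → ps ∼ qs → pieces ps ∼ pieces qs
pieces-∼ = ∼-hom pieces pieces-++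

infix 4 _≼_ _≼*_
_≼_ : Piece → ℕ → Set
(k , _) ≼ g = k ≤ g

_≼*_ : List Piece → List ℕ → Set
_≼*_ = Pointwise _≼_

⊆-block++⁻ : ∀ g {y w} → y ⊆ block g ++ w →
  ∃₂ λ k e → ∃ λ y′ → k ≤ g × y ≡ zeros k ++ oneIf e y′ × y′ ⊆ w
⊆-block++⁻ zero    (_ ∷ʳ s)     = 0 , false , _ , z≤n , refl , s
⊆-block++⁻ zero    (refl ∷ s)   = 0 , true , _ , z≤n , refl , s
⊆-block++⁻ (suc g) (_ ∷ʳ s) with ⊆-block++⁻ g s
... | k , e , y′ , k≤g , eq , s′ = k , e , y′ , m≤n⇒m≤1+n k≤g , eq , s′
⊆-block++⁻ (suc g) (refl ∷ s) with ⊆-block++⁻ g s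
... | k , e , y′ , k≤g , refl , s′ = suc k , e , y′ , s≤s k≤g , refl , s′

⊆-blocks⁻ : ∀ gs {y} → y ⊆ blocks gs → ∃ λ ps → ps ≼* gs × y ≡ pieces ps
⊆-blocks⁻ []       []  = [] , [] , refl
⊆-blocks⁻ (g ∷ gs) s with ⊆-block++⁻ g s
... | k , e , y′ , k≤g , refl , s′ with ⊆-blocks⁻ gs s′
...   | ps , ps≼gs , refl = (k , e) ∷ ps , k≤g ∷ ps≼gs , refl

oneIf-⊆-block++ : ∀ e g {y w} → y ⊆ w → oneIf e y ⊆ block g ++ w
oneIf-⊆-block++ true  zero    s = refl ∷ s
oneIf-⊆-block++ false zero    s = 𝟙 ∷ʳ s
oneIf-⊆-block++ e     (suc g) s = 𝟘 ∷ʳ oneIf-⊆-block++ e g s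

piece-⊆-block++ : ∀ {k g} e {y w} → k ≤ g → y ⊆ w → zeros k ++ oneIf e y ⊆ block g ++ w
piece-⊆-block++ {g = g} e z≤n     s = oneIf-⊆-block++ e g s
piece-⊆-block++         e (s≤s l) s = refl ∷ piece-⊆-block++ e l s

pieces-⊆-blocks : ∀ {ps gs} → ps ≼* gs → pieces ps ⊆ blocks gs
pieces-⊆-blocks []                      = []
pieces-⊆-blocks {(_ , e) ∷ _} (l ∷ ls) = piece-⊆-block++ e l (pieces-⊆-blocks ls)

gapsFrom : ℕ → List Piece → List ℕ
gapsFrom c []                 = []
gapsFrom c ((k , true)  ∷ ps) = c + k ∷ gapsFrom 0 ps
gapsFrom c ((k , false) ∷ ps) = gapsFrom (c + k) ps

trailingFrom : ℕ → List Piece → ℕ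
trailingFrom c []                 = c
trailingFrom c ((k , true)  ∷ ps) = trailingFrom 0 ps
trailingFrom c ((k , false) ∷ ps) = trailingFrom (c + k) ps

zeros++pieces : ∀ c ps → zeros c ++ pieces ps ≡ blocks (gapsFrom c ps) ++ zeros (trailingFrom c ps)
zeros++pieces c [] = ++-identityʳ (zeros c)
zeros++pieces c ((k , true) ∷ ps) = begin
  zeros c ++ zeros k ++ 𝟙 ∷ pieces ps        ≡⟨ zeros-+ c k _ ⟩
  zeros (c + k) ++ 𝟙 ∷ pieces ps             ≡⟨ cong (λ w → zeros (c + k) ++ 𝟙 ∷ w) (zeros++pieces 0 ps) ⟩
  zeros (c + k) ++ 𝟙 ∷ blocks gs ++ zeros t  ≡⟨ block-++ (c + k) _ ⟨
  block (c + k) ++ blocks gs ++ zeros t      ≡⟨ ++-assoc (block (c + k)) (blocks gs) (zeros t) ⟨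
  (block (c + k) ++ blocks gs) ++ zeros t    ∎
  where
  open ≡-Reasoning
  gs : List ℕ
  gs = gapsFrom 0 ps
  t : ℕ
  t = trailingFrom 0 ps
zeros++pieces c ((k , false) ∷ ps) = trans (zeros-+ c k (pieces ps)) (zeros++pieces (c + k) ps)

-- A record rather than a synonym, so that ps and qs can be inferred (pieces is not injective).
infix 4 _≈_
record _≈_ (ps qs : List Piece) : Set where
  constructor mk-≈
  field conjugate : pieces ps ∼ pieces qs

≈-refl : ∀ {ps} → ps ≈ ps
≈-refl = mk-≈ ∼-refl

≈-rotate : ∀ i {ps} → ps ≈ drop i ps ++ take i ps
≈-rotate i {ps} = mk-≈ (pieces-∼ (rotate-∼ i ps))

≈-via-gaps : ∀ i j {ps qs} →
  let ps′ = drop i ps ++ take i ps ; qs′ = drop j qs ++ take j qs in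
  gapsFrom 0 ps′ ≡ gapsFrom 0 qs′ → trailingFrom 0 ps′ ≡ trailingFrom 0 qs′ → ps ≈ qs
≈-via-gaps i j {ps} {qs} g t = mk-≈ (∼-trans (pieces-∼ (rotate-∼ i ps))
  (∼-trans (∼-reflexive same) (∼-sym (pieces-∼ (rotate-∼ j qs)))))
  where
  ps′ qs′ : List Piece
  ps′ = drop i ps ++ take i ps
  qs′ = drop j qs ++ take j qs
  same : pieces ps′ ≡ pieces qs′
  same = trans (zeros++pieces 0 ps′) (trans (cong₂ (λ gs t → blocks gs ++ zeros t) g t) (sym (zeros++pieces 0 qs′)))

≈-shift : ∀ {a b c d e ps} → a + b ≡ c + d → ((a , false) ∷ (b , e) ∷ ps) ≈ ((c , false) ∷ (d , e) ∷ ps)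
≈-shift {a} {b} {c} {d} {e} {ps} eq = mk-≈ (∼-reflexive (begin
  zeros a ++ zeros b ++ w    ≡⟨ zeros-+ a b w ⟩
  zeros (a + b) ++ w         ≡⟨ cong (λ n → zeros n ++ w) eq ⟩
  zeros (c + d) ++ w         ≡⟨ zeros-+ c d w ⟨
  zeros c ++ zeros d ++ w    ∎))
  where
  open ≡-Reasoning
  w : Word
  w = oneIf e (pieces ps)

Fits : List Piece → List ℕ → Set
Fits ps gs = ∃ λ qs → ps ≈ qs × qs ≼* gs

Fits⇒⊆ᶜ : ∀ {ps gs} → Fits ps gs → pieces ps ⊆ᶜ blocks gs
Fits⇒⊆ᶜ (qs , mk-≈ c , b) = pieces qs , c , pieces-⊆-blocks b

split-≤-+ : ∀ x y {n} → n ≤ x + y → ∃₂ λ a b → a ≤ x × b ≤ y × a + b ≡ n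
split-≤-+ x y {n} n≤x+y with n ≤? x
... | yes n≤x = n , 0 , n≤x , z≤n , +-identityʳ n
... | no  n≰x = x , n ∸ x , ≤-refl , m≤n+o⇒m∸n≤o n x n≤x+y , m+[n∸m]≡n (<⇒≤ (≰⇒> n≰x))

pieceLength : Piece → ℕ
pieceLength (k , true)  = suc k
pieceLength (k , false) = k

size : List Piece → ℕ
size ps = sum (map pieceLength ps)

length-pieces : ∀ ps → length (pieces ps) ≡ size ps
length-pieces [] = refl
length-pieces ((k , true) ∷ ps) = begin
  length (zeros k ++ 𝟙 ∷ pieces ps)   ≡⟨ length-++ (zeros k) ⟩
  length (zeros k) + suc (length (pieces ps)) ≡⟨ cong₂ (λ a b → a + suc b) (length-replicate k) (length-pieces ps) ⟩
  k + suc (size ps)                   ≡⟨ +-suc k (size ps) ⟩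
  suc (k + size ps)                   ∎
  where open ≡-Reasoning
length-pieces ((k , false) ∷ ps) = begin
  length (zeros k ++ pieces ps)       ≡⟨ length-++ (zeros k) ⟩
  length (zeros k) + length (pieces ps) ≡⟨ cong₂ _+_ (length-replicate k) (length-pieces ps) ⟩
  k + size ps                         ∎
  where open ≡-Reasoning

ones : Word → ℕ
ones []          = 0
ones (zero  ∷ w) = ones w
ones (suc _ ∷ w) = suc (ones w)

ones-++ : ∀ u w → ones (u ++ w) ≡ ones u + ones w
ones-++ []          w = refl
ones-++ (zero  ∷ u) w = ones-++ u w
ones-++ (suc _ ∷ u) w = cong suc (ones-++ u w)

ones-zeros++ : ∀ k w → ones (zeros k ++ w) ≡ ones w
ones-zeros++ zero    w = refl
ones-zeros++ (suc k) w = ones-zeros++ k w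

ones-blocks : ∀ gs → ones (blocks gs) ≡ length gs
ones-blocks []       = refl
ones-blocks (g ∷ gs) = begin
  ones (block g ++ blocks gs)     ≡⟨ cong ones (block-++ g (blocks gs)) ⟩
  ones (zeros g ++ 𝟙 ∷ blocks gs) ≡⟨ ones-zeros++ g _ ⟩
  suc (ones (blocks gs))          ≡⟨ cong suc (ones-blocks gs) ⟩
  suc (length gs)                 ∎
  where open ≡-Reasoning

ones-pieces-≤ : ∀ ps → ones (pieces ps) ≤ length ps
ones-pieces-≤ [] = z≤n
ones-pieces-≤ ((k , true) ∷ ps) =
  ≤-trans (≤-reflexive (ones-zeros++ k _)) (s≤s (ones-pieces-≤ ps))
ones-pieces-≤ ((k , false) ∷ ps) =
  ≤-trans (≤-reflexive (ones-zeros++ k _)) (m≤n⇒m≤1+n (ones-pieces-≤ ps))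

pieces-full : ∀ ps → ones (pieces ps) ≡ length ps → pieces ps ≡ blocks (map proj₁ ps)
pieces-full [] _ = refl
pieces-full ((k , true) ∷ ps) full = begin
  zeros k ++ 𝟙 ∷ pieces ps              ≡⟨ cong (λ w → zeros k ++ 𝟙 ∷ w) (pieces-full ps full′) ⟩
  zeros k ++ 𝟙 ∷ blocks (map proj₁ ps)  ≡⟨ block-++ k _ ⟨
  block k ++ blocks (map proj₁ ps)      ∎
  where
  open ≡-Reasoning
  full′ : ones (pieces ps) ≡ length ps
  full′ = suc-injective (trans (sym (ones-zeros++ k _)) full)
pieces-full ((k , false) ∷ ps) full =
  ⊥-elim (1+n≰n (subst (_≤ length ps) (trans (sym (ones-zeros++ k _)) full) (ones-pieces-≤ ps)))

blocks-as-pieces : ∀ gs → pieces (map (_, true) gs) ≡ blocks gs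
blocks-as-pieces []       = refl
blocks-as-pieces (g ∷ gs) = trans (cong (λ w → zeros g ++ 𝟙 ∷ w) (blocks-as-pieces gs)) (sym (block-++ g (blocks gs)))

blocks-∼ : ∀ {gs hs} → gs ∼ hs → blocks gs ∼ blocks hs
blocks-∼ = ∼-hom blocks blocks-++

block++-injective : ∀ g h {w w′} → block g ++ w ≡ block h ++ w′ → g ≡ h × w ≡ w′
block++-injective zero    zero    eq = refl , ∷-injectiveʳ eq
block++-injective (suc g) (suc h) eq with block++-injective g h (∷-injectiveʳ eq)
... | refl , eq′ = refl , eq′

blocks-injective : ∀ gs hs → blocks gs ≡ blocks hs → gs ≡ hs
blocks-injective []           []           _  = refl
blocks-injective []           (zero  ∷ hs) ()
blocks-injective []           (suc _ ∷ hs) ()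
blocks-injective (zero  ∷ gs) []           ()
blocks-injective (suc _ ∷ gs) []           ()
blocks-injective (g ∷ gs)     (h ∷ hs)     eq with block++-injective g h eq
... | refl , eq′ = cong (g ∷_) (blocks-injective gs hs eq′)

EndsIn𝟙 : Word → Set
EndsIn𝟙 w = w ≡ [] ⊎ ∃ λ w′ → w ≡ w′ ++ [ 𝟙 ]

EndsIn𝟙-++⁻ : ∀ u w → EndsIn𝟙 (u ++ w) → EndsIn𝟙 w
EndsIn𝟙-++⁻ u w (inj₁ eq) = inj₁ (++-conicalʳ u w eq)
EndsIn𝟙-++⁻ u w (inj₂ (w′ , eq)) with ++-≡-++-cases u w w′ [ 𝟙 ] eq
... | inj₁ ([] , _ , w≡)     = inj₂ ([] , sym w≡)
... | inj₁ (_ ∷ es , _ , eq′) = inj₁ (++-conicalʳ es w (sym (∷-injectiveʳ eq′)))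
... | inj₂ (es , _ , w≡)     = inj₂ (es , w≡)

EndsIn𝟙-blocks : ∀ gs → EndsIn𝟙 (blocks gs)
EndsIn𝟙-blocks [] = inj₁ refl
EndsIn𝟙-blocks (g ∷ gs) with EndsIn𝟙-blocks gs
... | inj₁ eq        = inj₂ (zeros g , trans (cong (block g ++_) eq) (++-identityʳ (block g)))
... | inj₂ (w′ , eq) = inj₂ (block g ++ w′ , trans (cong (block g ++_) eq) (sym (++-assoc (block g) w′ [ 𝟙 ])))

block-last-𝟙 : ∀ g u w → block g ≡ (u ++ [ 𝟙 ]) ++ w → w ≡ []
block-last-𝟙 zero    []          w eq = sym (∷-injectiveʳ eq)
block-last-𝟙 zero    (_ ∷ [])    w ()
block-last-𝟙 zero    (_ ∷ _ ∷ _) w ()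
block-last-𝟙 (suc g) []          w ()
block-last-𝟙 (suc g) (_ ∷ u)     w eq = block-last-𝟙 g u w (∷-injectiveʳ eq)

blocks-++⁻ : ∀ gs {u w} → u ++ w ≡ blocks gs → EndsIn𝟙 u →
  ∃₂ λ gs₁ gs₂ → gs ≡ gs₁ ++ gs₂ × u ≡ blocks gs₁ × w ≡ blocks gs₂
blocks-++⁻ [] {u} {w} eq _ = [] , [] , refl , ++-conicalˡ u w eq , ++-conicalʳ u w eq
blocks-++⁻ (g ∷ gs) {u} {w} eq end with ++-≡-++-cases u w (block g) (blocks gs) eq | end
... | inj₁ (es , refl , eq′) | _ with blocks-++⁻ gs (sym eq′) (EndsIn𝟙-++⁻ (block g) es end)
...   | gs₁ , gs₂ , refl , refl , refl = g ∷ gs₁ , gs₂ , refl , refl , refl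
blocks-++⁻ (g ∷ gs) eq end | inj₂ (es , refl , refl) | inj₁ refl = [] , g ∷ gs , refl , refl , refl
blocks-++⁻ (g ∷ gs) eq end | inj₂ (es , eq′ , refl) | inj₂ (u′ , refl) with block-last-𝟙 g u′ es eq′
... | refl = g ∷ [] , gs , refl , trans (sym (++-identityʳ _)) (trans (sym eq′) (sym (++-identityʳ (block g)))) , refl

blocks-∼⁻ : ∀ gs hs → blocks gs ∼ blocks hs → gs ∼ hs
blocks-∼⁻ gs hs (u , w , eq , eq′)
  with blocks-++⁻ gs (sym eq) (EndsIn𝟙-++⁻ w u (subst EndsIn𝟙 eq′ (EndsIn𝟙-blocks hs)))
... | gs₁ , gs₂ , refl , refl , refl =
  gs₁ , gs₂ , refl , blocks-injective hs (gs₂ ++ gs₁) (trans eq′ (sym (blocks-++ gs₂ gs₁)))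

∷ʳ≡∷⇒∼ : ∀ {x : A} {xs ys} → xs ++ [ x ] ≡ x ∷ ys → xs ∼ ys
∷ʳ≡∷⇒∼ {xs = []}     refl = ∼-refl
∷ʳ≡∷⇒∼ {xs = x ∷ xs} refl = ∼-swap [ x ] xs

zeros-∷ʳ : ∀ k → zeros k ++ [ 𝟘 ] ≡ 𝟘 ∷ zeros k
zeros-∷ʳ zero    = refl
zeros-∷ʳ (suc k) = cong (𝟘 ∷_) (zeros-∷ʳ k)

reverse-zeros : ∀ k → reverse (zeros k) ≡ zeros k
reverse-zeros zero    = refl
reverse-zeros (suc k) = trans (unfold-reverse 𝟘 (zeros k)) (trans (cong (_++ [ 𝟘 ]) (reverse-zeros k)) (zeros-∷ʳ k))

reverse-blocks-∷ʳ : ∀ gs → reverse (blocks gs) ++ [ 𝟙 ] ≡ 𝟙 ∷ blocks (reverse gs)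
reverse-blocks-∷ʳ []       = refl
reverse-blocks-∷ʳ (g ∷ gs) = begin
  reverse (block g ++ blocks gs) ++ [ 𝟙 ]        ≡⟨ cong (_++ [ 𝟙 ]) (reverse-++ (block g) (blocks gs)) ⟩
  (rev ++ reverse (block g)) ++ [ 𝟙 ]            ≡⟨ cong (λ w → (rev ++ w) ++ [ 𝟙 ]) reverse-block ⟩
  (rev ++ 𝟙 ∷ zeros g) ++ [ 𝟙 ]                  ≡⟨ ++-assoc rev (𝟙 ∷ zeros g) [ 𝟙 ] ⟩
  rev ++ [ 𝟙 ] ++ block g                        ≡⟨ ++-assoc rev [ 𝟙 ] (block g) ⟨
  (rev ++ [ 𝟙 ]) ++ block g                      ≡⟨ cong (_++ block g) (reverse-blocks-∷ʳ gs) ⟩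
  𝟙 ∷ blocks (reverse gs) ++ block g             ≡⟨ cong (λ w → 𝟙 ∷ blocks (reverse gs) ++ w) (++-identityʳ (block g)) ⟨
  𝟙 ∷ blocks (reverse gs) ++ blocks [ g ]        ≡⟨ cong (𝟙 ∷_) (blocks-++ (reverse gs) [ g ]) ⟨
  𝟙 ∷ blocks (reverse gs ++ [ g ])               ≡⟨ cong (λ hs → 𝟙 ∷ blocks hs) (unfold-reverse g gs) ⟨
  𝟙 ∷ blocks (reverse (g ∷ gs))                  ∎
  where
  open ≡-Reasoning
  rev : Word
  rev = reverse (blocks gs)
  reverse-block : reverse (block g) ≡ 𝟙 ∷ zeros g
  reverse-block = trans (reverse-++ (zeros g) [ 𝟙 ]) (cong (𝟙 ∷_) (reverse-zeros g))

reverse-blocks : ∀ gs → reverse (blocks gs) ∼ blocks (reverse gs)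
reverse-blocks gs = ∷ʳ≡∷⇒∼ (reverse-blocks-∷ʳ gs)

module SwappedGaps {p q r : ℕ} (p<q : p < q) (q<r : q < r) where

  U V : List ℕ
  U = p ∷ q ∷ r ∷ r ∷ []
  V = q ∷ p ∷ r ∷ r ∷ []

  L : ℕ
  L = 2 * p + q + 7

  private
    p≤q : p ≤ q
    p≤q = <⇒≤ p<q

    q≤r : q ≤ r
    q≤r = <⇒≤ q<r

    p≤r : p ≤ r
    p≤r = ≤-trans p≤q q≤r

    2+p≤r : 2 + p ≤ r
    2+p≤r = ≤-trans (s≤s p<q) q<r

    1≤q : 1 ≤ q
    1≤q = ≤-trans (s≤s z≤n) p<q

  Transfers : List Piece → Set
  Transfers ps = ps ≼* U → size ps < L → Fits ps V

  transfer-0 : ∀ {k₁ k₂ e₂ x₃ x₄} → Transfers ((k₁ , false) ∷ (k₂ , e₂) ∷ x₃ ∷ x₄ ∷ [])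
  transfer-0 {k₁} {k₂} (l₁ ∷ l₂ ∷ l₃ ∷ l₄ ∷ []) _ =
    let b , a , b≤p , a≤q , b+a≡k = split-≤-+ p q (+-mono-≤ l₁ l₂)
    in _ , ≈-shift (trans (sym b+a≡k) (+-comm b a)) , a≤q ∷ b≤p ∷ l₃ ∷ l₄ ∷ []

  transfer-1111 : ∀ {k₁ k₂ k₃ k₄} → Transfers ((k₁ , true) ∷ (k₂ , true) ∷ (k₃ , true) ∷ (k₄ , true) ∷ [])
  transfer-1111 {k₁} {k₂} {k₃} {k₄} (l₁ ∷ l₂ ∷ l₃ ∷ l₄ ∷ []) short with k₂ ≤? p | k₄ ≤? q | k₃ ≤? p
  ... | yes k₂≤p | _         | _        = _ , ≈-refl , ≤-trans l₁ p≤q ∷ k₂≤p ∷ l₃ ∷ l₄ ∷ []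
  ... | no _     | yes k₄≤q  | _        = _ , ≈-rotate 3 , k₄≤q ∷ l₁ ∷ ≤-trans l₂ q≤r ∷ l₃ ∷ []
  ... | no _     | no _      | yes k₃≤p = _ , ≈-rotate 1 , l₂ ∷ k₃≤p ∷ l₄ ∷ ≤-trans l₁ p≤r ∷ []
  ... | no k₂≰p  | no k₄≰q   | no k₃≰p  = ⊥-elim (<⇒≱ short (begin
    2 * p + q + 7                                        ≡⟨ L≡ p q ⟩
    1 + (suc (suc p) + (suc (suc p) + (suc (suc q) + 0))) ≤⟨ +-mono-≤ (s≤s z≤n) (+-mono-≤ (s≤s (≰⇒> k₂≰p))
                                                             (+-mono-≤ (s≤s (≰⇒> k₃≰p)) (+-monoˡ-≤ 0 (s≤s (≰⇒> k₄≰q))))) ⟩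
    suc k₁ + (suc k₂ + (suc k₃ + (suc k₄ + 0)))           ∎))
    where
    open ≤-Reasoning
    L≡ : ∀ p q → 2 * p + q + 7 ≡ 1 + (suc (suc p) + (suc (suc p) + (suc (suc q) + 0)))
    L≡ = solve-∀

  transfer-1011 : ∀ {k₁ k₂ k₃ k₄} → Transfers ((k₁ , true) ∷ (k₂ , false) ∷ (k₃ , true) ∷ (k₄ , true) ∷ [])
  transfer-1011 {k₁} {k₂} {k₃} {k₄} (l₁ ∷ l₂ ∷ l₃ ∷ l₄ ∷ []) short with k₂ + k₃ ≤? p + r | k₄ ≤? q
  ... | yes k₂+k₃≤p+r | _ =
    let a , b , a≤p , b≤r , a+b≡ = split-≤-+ p r k₂+k₃≤p+r
    in (k₁ , true) ∷ (a , false) ∷ (b , true) ∷ (k₄ , true) ∷ [] ,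
       ≈-via-gaps 0 0 (cong (λ g → k₁ ∷ g ∷ k₄ ∷ []) (sym a+b≡)) refl ,
       ≤-trans l₁ p≤q ∷ a≤p ∷ b≤r ∷ l₄ ∷ []
  ... | no _ | yes k₄≤q =
    let a , b , a≤r , b≤r , a+b≡ = split-≤-+ r r (+-mono-≤ (≤-trans l₂ q≤r) l₃)
    in (k₄ , true) ∷ (k₁ , true) ∷ (a , false) ∷ (b , true) ∷ [] ,
       ≈-via-gaps 3 0 (cong (λ g → k₄ ∷ k₁ ∷ g ∷ []) (sym a+b≡)) refl ,
       k₄≤q ∷ l₁ ∷ a≤r ∷ b≤r ∷ []
  ... | no k₂+k₃≰p+r | no k₄≰q = ⊥-elim (<⇒≱ short (begin
    2 * p + q + 7                  ≡⟨ L≡ p q ⟩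
    suc (p + (2 + p)) + suc q + 3  ≤⟨ +-monoˡ-≤ 3 (+-monoˡ-≤ (suc q) (s≤s (+-monoʳ-≤ p 2+p≤r))) ⟩
    suc (p + r) + suc q + 3        ≤⟨ +-monoˡ-≤ 3 (+-mono-≤ (≰⇒> k₂+k₃≰p+r) (≰⇒> k₄≰q)) ⟩
    k₂ + k₃ + k₄ + 3               ≤⟨ m≤n+m _ k₁ ⟩
    k₁ + (k₂ + k₃ + k₄ + 3)        ≡⟨ size≡ k₁ k₂ k₃ k₄ ⟩
    suc k₁ + (k₂ + (suc k₃ + (suc k₄ + 0))) ∎))
    where
    open ≤-Reasoning
    L≡ : ∀ p q → 2 * p + q + 7 ≡ suc (p + (2 + p)) + suc q + 3
    L≡ = solve-∀
    size≡ : ∀ k₁ k₂ k₃ k₄ → k₁ + (k₂ + k₃ + k₄ + 3) ≡ suc k₁ + (k₂ + (suc k₃ + (suc k₄ + 0)))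
    size≡ = solve-∀

  transfer-1101 : ∀ {k₁ k₂ k₃ k₄} → Transfers ((k₁ , true) ∷ (k₂ , true) ∷ (k₃ , false) ∷ (k₄ , true) ∷ [])
  transfer-1101 {k₁} {k₂} {k₃} {k₄} (l₁ ∷ l₂ ∷ l₃ ∷ l₄ ∷ []) short with k₂ ≤? p | k₃ + k₄ ≤? r + q
  ... | yes k₂≤p | _ = _ , ≈-refl , ≤-trans l₁ p≤q ∷ k₂≤p ∷ l₃ ∷ l₄ ∷ []
  ... | no _ | yes k₃+k₄≤r+q =
    let c , d , c≤r , d≤q , c+d≡ = split-≤-+ r q k₃+k₄≤r+q
    in (d , true) ∷ (k₁ , true) ∷ (k₂ , true) ∷ (c , false) ∷ [] ,
       ≈-via-gaps 2 3 (cong (λ g → g ∷ k₁ ∷ k₂ ∷ []) (sym c+d≡)) refl ,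
       d≤q ∷ l₁ ∷ ≤-trans l₂ q≤r ∷ c≤r ∷ []
  ... | no k₂≰p | no k₃+k₄≰r+q = ⊥-elim (<⇒≱ short (begin
    2 * p + q + 7                  ≡⟨ L≡ p q ⟩
    suc p + suc (2 + p + q) + 3    ≤⟨ +-monoˡ-≤ 3 (+-monoʳ-≤ (suc p) (s≤s (+-monoˡ-≤ q 2+p≤r))) ⟩
    suc p + suc (r + q) + 3        ≤⟨ +-monoˡ-≤ 3 (+-mono-≤ (≰⇒> k₂≰p) (≰⇒> k₃+k₄≰r+q)) ⟩
    k₂ + (k₃ + k₄) + 3             ≤⟨ m≤n+m _ k₁ ⟩
    k₁ + (k₂ + (k₃ + k₄) + 3)      ≡⟨ size≡ k₁ k₂ k₃ k₄ ⟩
    suc k₁ + (suc k₂ + (k₃ + (suc k₄ + 0))) ∎))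
    where
    open ≤-Reasoning
    L≡ : ∀ p q → 2 * p + q + 7 ≡ suc p + suc (2 + p + q) + 3
    L≡ = solve-∀
    size≡ : ∀ k₁ k₂ k₃ k₄ → k₁ + (k₂ + (k₃ + k₄) + 3) ≡ suc k₁ + (suc k₂ + (k₃ + (suc k₄ + 0)))
    size≡ = solve-∀

  transfer-1110 : ∀ {k₁ k₂ k₃ k₄} → Transfers ((k₁ , true) ∷ (k₂ , true) ∷ (k₃ , true) ∷ (k₄ , false) ∷ [])
  transfer-1110 {k₁} {k₂} {k₃} {k₄} (l₁ ∷ l₂ ∷ l₃ ∷ l₄ ∷ []) short with k₂ ≤? p | k₃ ≤? q | k₄ + k₁ ≤? q + p
  ... | yes k₂≤p | _ | _ =
    let b , a , b≤r , a≤q , b+a≡ = split-≤-+ r q (+-mono-≤ l₄ (≤-trans l₁ p≤q))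
    in (a , true) ∷ (k₂ , true) ∷ (k₃ , true) ∷ (b , false) ∷ [] ,
       ≈-via-gaps 3 3 (cong (λ g → g ∷ k₂ ∷ k₃ ∷ []) (sym b+a≡)) refl ,
       a≤q ∷ k₂≤p ∷ l₃ ∷ b≤r ∷ []
  ... | no _ | yes k₃≤q | _ =
    let a , b , a≤p , b≤r , a+b≡ = split-≤-+ p r (≤-trans (+-mono-≤ l₄ l₁) (≤-reflexive (+-comm r p)))
    in (k₃ , true) ∷ (a , false) ∷ (b , true) ∷ (k₂ , true) ∷ [] ,
       ≈-via-gaps 2 0 (cong (λ g → k₃ ∷ g ∷ k₂ ∷ []) (sym a+b≡)) refl ,
       k₃≤q ∷ a≤p ∷ b≤r ∷ ≤-trans l₂ q≤r ∷ []
  ... | no _ | no _ | yes k₄+k₁≤q+p =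
    let a , b , a≤q , b≤p , a+b≡ = split-≤-+ q p k₄+k₁≤q+p
    in (a , false) ∷ (b , true) ∷ (k₂ , true) ∷ (k₃ , true) ∷ [] ,
       ≈-via-gaps 3 0 (cong (λ g → g ∷ k₂ ∷ k₃ ∷ []) (sym a+b≡)) refl ,
       a≤q ∷ b≤p ∷ ≤-trans l₂ q≤r ∷ l₃ ∷ []
  ... | no k₂≰p | no k₃≰q | no k₄+k₁≰q+p = ⊥-elim (<⇒≱ short (begin
    2 * p + q + 7                  ≡⟨ L≡ p q ⟩
    suc (1 + p) + suc p + suc q + 3 ≤⟨ +-monoˡ-≤ 3 (+-monoˡ-≤ (suc q) (+-monoˡ-≤ (suc p) (s≤s (+-monoˡ-≤ p 1≤q)))) ⟩
    suc (q + p) + suc p + suc q + 3 ≤⟨ +-monoˡ-≤ 3 (+-mono-≤ (+-mono-≤ (≰⇒> k₄+k₁≰q+p) (≰⇒> k₂≰p)) (≰⇒> k₃≰q)) ⟩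
    k₄ + k₁ + k₂ + k₃ + 3          ≡⟨ size≡ k₁ k₂ k₃ k₄ ⟩
    suc k₁ + (suc k₂ + (suc k₃ + (k₄ + 0))) ∎))
    where
    open ≤-Reasoning
    L≡ : ∀ p q → 2 * p + q + 7 ≡ suc (1 + p) + suc p + suc q + 3
    L≡ = solve-∀
    size≡ : ∀ k₁ k₂ k₃ k₄ → k₄ + k₁ + k₂ + k₃ + 3 ≡ suc k₁ + (suc k₂ + (suc k₃ + (k₄ + 0)))
    size≡ = solve-∀

  transfer-1001 : ∀ {k₁ k₂ k₃ k₄} → Transfers ((k₁ , true) ∷ (k₂ , false) ∷ (k₃ , false) ∷ (k₄ , true) ∷ [])
  transfer-1001 {k₁} {k₂} {k₃} {k₄} (l₁ ∷ l₂ ∷ l₃ ∷ l₄ ∷ []) _ =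
    let R , a , R≤r+r , a≤q , R+a≡ = split-≤-+ (r + r) q bound
        b , c , b≤r , c≤r , b+c≡R = split-≤-+ r r R≤r+r
    in (a , true) ∷ (k₁ , true) ∷ (b , false) ∷ (c , false) ∷ [] ,
       ≈-via-gaps 1 2 (cong (_∷ k₁ ∷ []) (sym (trans (cong (_+ a) b+c≡R) R+a≡))) refl ,
       a≤q ∷ l₁ ∷ b≤r ∷ c≤r ∷ []
    where
    bound : k₂ + k₃ + k₄ ≤ r + r + q
    bound = ≤-trans (+-mono-≤ (+-mono-≤ l₂ l₃) l₄) (≤-reflexive (trans (+-assoc q r r) (+-comm q (r + r))))

  transfer-1010 : ∀ {k₁ k₂ k₃ k₄} → Transfers ((k₁ , true) ∷ (k₂ , false) ∷ (k₃ , true) ∷ (k₄ , false) ∷ [])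
  transfer-1010 {k₁} {k₂} {k₃} {k₄} (l₁ ∷ l₂ ∷ l₃ ∷ l₄ ∷ []) _ =
    let a , d , a≤q , d≤r , a+d≡ = split-≤-+ q r (+-mono-≤ l₂ l₃)
        c , b , c≤r , b≤p , c+b≡ = split-≤-+ r p (+-mono-≤ l₄ l₁)
    in (a , true) ∷ (b , false) ∷ (c , true) ∷ (d , false) ∷ [] ,
       ≈-via-gaps 1 3 (cong₂ (λ g h → g ∷ h ∷ []) (sym (trans (+-comm d a) a+d≡))
                                                  (sym (trans (+-comm b c) c+b≡))) refl ,
       a≤q ∷ b≤p ∷ c≤r ∷ d≤r ∷ []

  transfer-1100 : ∀ {k₁ k₂ k₃ k₄} → Transfers ((k₁ , true) ∷ (k₂ , true) ∷ (k₃ , false) ∷ (k₄ , false) ∷ [])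
  transfer-1100 {k₁} {k₂} {k₃} {k₄} (l₁ ∷ l₂ ∷ l₃ ∷ l₄ ∷ []) _ =
    let R , c , R≤p+r , c≤r , R+c≡ = split-≤-+ (p + r) r bound
        a , b , a≤p , b≤r , a+b≡R = split-≤-+ p r R≤p+r
    in (k₂ , true) ∷ (a , false) ∷ (b , false) ∷ (c , true) ∷ [] ,
       ≈-via-gaps 1 0 (cong (λ g → k₂ ∷ g ∷ []) (sym (trans (cong (_+ c) a+b≡R) R+c≡))) refl ,
       l₂ ∷ a≤p ∷ b≤r ∷ c≤r ∷ []
    where
    bound : k₃ + k₄ + k₁ ≤ p + r + r
    bound = ≤-trans (+-mono-≤ (+-mono-≤ l₃ l₄) l₁) (≤-reflexive (trans (+-comm (r + r) p) (sym (+-assoc p r r))))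

  transfer-1000 : ∀ {k₁ k₂ k₃ k₄} → Transfers ((k₁ , true) ∷ (k₂ , false) ∷ (k₃ , false) ∷ (k₄ , false) ∷ [])
  transfer-1000 {k₁} {k₂} {k₃} {k₄} (l₁ ∷ l₂ ∷ l₃ ∷ l₄ ∷ []) _ =
    let R , d , R≤q+p+r , d≤r , R+d≡ = split-≤-+ (q + p + r) r bound
        S , c , S≤q+p , c≤r , S+c≡R = split-≤-+ (q + p) r R≤q+p+r
        a , b , a≤q , b≤p , a+b≡S = split-≤-+ q p S≤q+p
    in (a , false) ∷ (b , false) ∷ (c , false) ∷ (d , true) ∷ [] ,
       ≈-via-gaps 1 0 (cong (_∷ []) (sym (trans (cong (λ x → x + c + d) a+b≡S)
                                                (trans (cong (_+ d) S+c≡R) R+d≡)))) refl ,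
       a≤q ∷ b≤p ∷ c≤r ∷ d≤r ∷ []
    where
    reorder : ∀ p q r → q + r + r + p ≡ q + p + r + r
    reorder = solve-∀
    bound : k₂ + k₃ + k₄ + k₁ ≤ q + p + r + r
    bound = ≤-trans (+-mono-≤ (+-mono-≤ (+-mono-≤ l₂ l₃) l₄) l₁) (≤-reflexive (reorder p q r))

  transfer : ∀ {x₁ x₂ x₃ x₄} → Transfers (x₁ ∷ x₂ ∷ x₃ ∷ x₄ ∷ [])
  transfer {_ , false}                                     = transfer-0
  transfer {_ , true} {_ , true}  {_ , true}  {_ , true}  = transfer-1111
  transfer {_ , true} {_ , false} {_ , true}  {_ , true}  = transfer-1011
  transfer {_ , true} {_ , true}  {_ , false} {_ , true}  = transfer-1101
  transfer {_ , true} {_ , true}  {_ , true}  {_ , false} = transfer-1110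
  transfer {_ , true} {_ , false} {_ , false} {_ , true}  = transfer-1001
  transfer {_ , true} {_ , false} {_ , true}  {_ , false} = transfer-1010
  transfer {_ , true} {_ , true}  {_ , false} {_ , false} = transfer-1100
  transfer {_ , true} {_ , false} {_ , false} {_ , false} = transfer-1000

  shortU⇒V : ∀ {x} → length x < L → x ⊆ᶜ blocks U → x ⊆ᶜ blocks V
  shortU⇒V {x} short (y , x∼y , y⊆U) with ⊆-blocks⁻ U y⊆U
  ... | ps , bounds@(_ ∷ _ ∷ _ ∷ _ ∷ []) , refl =
    ⊆ᶜ-respˡ-∼ x∼y (Fits⇒⊆ᶜ (transfer bounds (subst (_< L) (trans (∼-length x∼y) (length-pieces ps)) short)))

  reverseV∼U : reverse (blocks V) ∼ blocks U
  reverseV∼U = ∼-trans (reverse-blocks V) (blocks-∼ (rotate-∼ 2 (reverse V)))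

  shortV⇒U : ∀ {x} → length x < L → x ⊆ᶜ blocks V → x ⊆ᶜ blocks U
  shortV⇒U {x} short x⊆V = subst (_⊆ᶜ blocks U) (reverse-involutive x)
    (⊆ᶜ-respʳ-∼ (⊆ᶜ-reverse (shortU⇒V (subst (_< L) (sym (length-reverse x)) short)
                                       (⊆ᶜ-respʳ-∼ (⊆ᶜ-reverse x⊆V) reverseV∼U)))
                reverseV∼U)

  witness : List ℕ
  witness = 0 ∷ suc p ∷ suc p ∷ suc q ∷ []

  length-witness : length (blocks witness) ≡ L
  length-witness = begin
    length (blocks witness)                  ≡⟨ cong length (blocks-as-pieces witness) ⟨
    length (pieces (map (_, true) witness))  ≡⟨ length-pieces (map (_, true) witness) ⟩
    1 + (suc (suc p) + (suc (suc p) + (suc (suc q) + 0)))  ≡⟨ size≡L p q ⟩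
    2 * p + q + 7                            ∎
    where
    open ≡-Reasoning
    size≡L : ∀ p q → 1 + (suc (suc p) + (suc (suc p) + (suc (suc q) + 0))) ≡ 2 * p + q + 7
    size≡L = solve-∀

  witness⊆ᶜU : blocks witness ⊆ᶜ blocks U
  witness⊆ᶜU = _ , ∼-refl , subst (_⊆ blocks U) (blocks-as-pieces witness)
    (pieces-⊆-blocks {map (_, true) witness} {U} (z≤n ∷ p<q ∷ ≤-trans p<q q≤r ∷ q<r ∷ []))

  witness-rotation-exceeds : ∀ {k₁ k₂ k₃ k₄} → witness ∼ (k₁ ∷ k₂ ∷ k₃ ∷ k₄ ∷ []) → k₁ ≤ q → k₂ ≤ p → ⊥
  witness-rotation-exceeds ([]                    , _ , refl , refl) _    k₂≤p = 1+n≰n k₂≤p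
  witness-rotation-exceeds (_ ∷ []                , _ , refl , refl) _    k₂≤p = 1+n≰n k₂≤p
  witness-rotation-exceeds (_ ∷ _ ∷ []            , _ , refl , refl) _    k₂≤p = 1+n≰n (≤-trans (s≤s p≤q) k₂≤p)
  witness-rotation-exceeds (_ ∷ _ ∷ _ ∷ []        , _ , refl , refl) k₁≤q _    = 1+n≰n k₁≤q
  witness-rotation-exceeds (_ ∷ _ ∷ _ ∷ _ ∷ []    , _ , refl , refl) _    k₂≤p = 1+n≰n k₂≤p
  witness-rotation-exceeds (_ ∷ _ ∷ _ ∷ _ ∷ _ ∷ _ , _ , ()   , _)

  witness-⊈ᶜV : ¬ (blocks witness ⊆ᶜ blocks V)
  witness-⊈ᶜV (z , c , z⊆V) with ⊆-blocks⁻ V z⊆V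
  ... | ps@(_ ∷ _ ∷ _ ∷ _ ∷ []) , k₁≤q ∷ k₂≤p ∷ _ ∷ _ ∷ [] , refl =
    witness-rotation-exceeds
      (blocks-∼⁻ witness (map proj₁ ps) (∼-trans c (∼-reflexive (pieces-full ps full)))) k₁≤q k₂≤p
    where
    full : ones (pieces ps) ≡ 4
    full = trans (sym (∼-invariant ones ones-++ c)) (ones-blocks witness)

  minDistLength : MinDistLength L (w4 p q r r) (w4 q p r r)
  minDistLength rewrite w4≡blocks p q r r | w4≡blocks q p r r =
      (blocks witness , length-witness , inj₁ (⊆ᶜ⇒CycSubword witness⊆ᶜU , witness-⊈ᶜV ∘ CycSubword⇒⊆ᶜ))
    , λ where
        x short (inj₁ (x⊆U , x⊈V)) → x⊈V (⊆ᶜ⇒CycSubword (shortU⇒V short (CycSubword⇒⊆ᶜ x⊆U)))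
        x short (inj₂ (x⊈U , x⊆V)) → x⊈U (⊆ᶜ⇒CycSubword (shortV⇒U short (CycSubword⇒⊆ᶜ x⊆V)))

proposition1 : (∀ (m : ℕ) → 2 ≤ m →
      MinDistLength (3 * m + 2)
        (w4 (m ∸ 2) (m ∸ 1) (m + 1) (m + 1))
        (w4 (m ∸ 1) (m ∸ 2) (m + 1) (m + 1)))
    × (∀ (m : ℕ) → 2 ≤ m →
      MinDistLength (3 * m + 3)
        (w4 (m ∸ 2) m (m + 1) (m + 1))
        (w4 m (m ∸ 2) (m + 1) (m + 1)))
    × (∀ (m : ℕ) → 1 ≤ m →
      MinDistLength (3 * m + 5)
        (w4 (m ∸ 1) m (m + 1) (m + 1))
        (w4 m (m ∸ 1) (m + 1) (m + 1)))
    × (∀ (m : ℕ) → 2 ≤ m →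
      MinDistLength (3 * m + 3)
        (w4 (m ∸ 2) m (m + 2) (m + 2))
        (w4 m (m ∸ 2) (m + 2) (m + 2)))
proposition1 =
    (λ { (suc (suc t)) (s≤s (s≤s z≤n)) →
           withLength (L₁ t) (minDistLength (n<1+n t) (<-≤-trans (n<1+n (suc t)) (m≤m+n (suc (suc t)) 1))) })
  , (λ { (suc (suc t)) (s≤s (s≤s z≤n)) →
           withLength (L₂ t) (minDistLength (s≤s (n≤1+n t)) (m<m+n (suc (suc t)) (s≤s z≤n))) })
  , (λ { (suc t) (s≤s z≤n) →
           withLength (L₃ t) (minDistLength (n<1+n t) (m<m+n (suc t) (s≤s z≤n))) })
  , (λ { (suc (suc t)) (s≤s (s≤s z≤n)) →
           withLength (L₂ t) (minDistLength (s≤s (n≤1+n t)) (m<m+n (suc (suc t)) (s≤s z≤n))) })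
  where
  open SwappedGaps using (minDistLength)
  withLength : ∀ {L L′ u v} → L ≡ L′ → MinDistLength L u v → MinDistLength L′ u v
  withLength refl d = d
  L₁ : ∀ t → 2 * t + suc t + 7 ≡ 3 * suc (suc t) + 2
  L₁ = solve-∀
  L₂ : ∀ t → 2 * t + suc (suc t) + 7 ≡ 3 * suc (suc t) + 3
  L₂ = solve-∀
  L₃ : ∀ t → 2 * t + suc t + 7 ≡ 3 * suc t + 5
  L₃ = solve-∀
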